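{- For a presentation of a pre-d-frame as in the context, ($\lambda^3_+$) implies ($\lambda^2_+$), and ($\lambda^3_-$) implies ($\lambda^2_-$), where: ($\lambda^2_+$): $\alpha\in\mathcal D(\downarrow\mathsf{con}_{\wedge,\vee})$, $\beta\in\mathsf{tot}_\wedge$, $\beta_+\le\alpha_+$ imply $\alpha_-\le\beta_-$; ($\lambda^2_-$): $\alpha\in\mathcal D(\downarrow\mathsf{con}_{\wedge,\vee})$, $\beta\in\mathsf{tot}_\vee$, $\beta_-\le\alpha_-$ imply $\alpha_+\le\beta_+$; ($\lambda^3_+$): $\alpha\in\mathsf{con}_{\wedge,\vee,\bigvee}$, $\beta\in\mathsf{tot}_\wedge$, $\beta_+\le\alpha_+$ imply $\alpha_-\le\beta_-$; ($\lambda^3_-$): $\alpha\in\mathsf{con}_{\wedge,\vee,\bigwedge}$, $\beta\in\mathsf{tot}_\vee$, $\beta_-\le\alpha_-$ imply $\alpha_+\le\beta_+$.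
   Context: Let $(B_\pm,\mathcal C_\pm)$ be frame presentations ($B$ a meet-semilattice with top, $\mathcal C$ a set of pairs $U\dashv a$ with $a\in B$, $U\subseteq\downarrow a$, stable: $U\dashv a\in\mathcal C$, $b\le a\Rightarrow\{u\wedge b:u\in U\}\dashv b\in\mathcal C$), $L_\pm$ the frame of $\mathcal C_\pm$-ideals (downsets $I$ with $U\dashv a\in\mathcal C,U\subseteq I\Rightarrow a\in I$, ordered by inclusion), $b\in B_\pm$ identified with the smallest $\mathcal C_\pm$-ideal containing it, and $\mathsf{con}_1,\mathsf{tot}_1\subseteq B_+\times B_-\subseteq L_+\times L_-$. On $L_+\times L_-$: $\alpha\sqsubseteq\beta$ iff $\alpha_+\le\beta_+,\alpha_-\le\beta_-$; logical join $(\alpha_+\vee\beta_+,\alpha_-\wedge\beta_-)$, logical meet $(\alpha_+\wedge\beta_+,\alpha_-\vee\beta_-)$. $\mathsf{con}_{\wedge,\vee}$ is the closure of $\mathsf{con}_1$ under finite logical meets and joins; $\mathsf{tot}_\wedge$, $\mathsf{tot}_\vee$ are the closures of $\mathsf{tot}_1$ under finite logical meets, resp. joins. $\mathsf{con}_{\wedge,\vee,\bigvee}=\{(\bigvee_i\alpha^i_+,\bigwedge_i\alpha^i_-):\{\alpha^i\}_i\subseteq\mathsf{con}_{\wedge,\vee}\}$ and $\mathsf{con}_{\wedge,\vee,\bigwedge}=\{(\bigwedge_i\alpha^i_+,\bigvee_i\alpha^i_-):\{\alpha^i\}_i\subseteq\mathsf{con}_{\wedge,\vee}\}$ (arbitrary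 families). $\downarrow$ is $\sqsubseteq$-downward closure. $\mathcal D(R)=\{(\bigvee_{\alpha\in A}\alpha_+,\bigvee_{\alpha\in A}\alpha_-): A\subseteq R\ \sqsubseteq\text{ -directed}\}$. -}

module Defs where

open import Data.Product using (Σ; ∃; _×_; _,_; proj₁; proj₂)
open import Data.Sum using (_⊎_)
open import Data.Empty using (⊥)
open import Data.Unit using (⊤)
open import Function.Bundles using (_⇔_)
open import Relation.Binary.PropositionalEquality using (_≡_)
open import Relation.Binary.Lattice.Structures using (IsBoundedMeetSemilattice)

-- C : a *set* of pairs U ⊣ a.  It is represented, for each a, by an index
--     set  Cov a  of the covers of a, each index c carrying its subset
--     U c ⊆ B (a predicate).

record FramePresentation : Set₁ where
  field
    B       : Set
    _≤_     : B → B → Set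
    _∧_     : B → B → B
    top     : B
    isBMSL  : IsBoundedMeetSemilattice _≡_ _≤_ _∧_ top
    Cov     : B → Set
    U       : ∀ {a} → Cov a → B → Set
    U⊆↓a    : ∀ {a} (c : Cov a) {u} → U c u → u ≤ a
    stable  : ∀ {a b} (c : Cov a) → b ≤ a →
              Σ (Cov b) λ c' → ∀ x → (U c' x ⇔ ∃ λ u → U c u × (x ≡ (u ∧ b)))

module Pres (P : FramePresentation) where
  open FramePresentation P

  record Ideal : Set₁ where
    field
      mem    : B → Set
      down   : ∀ {a b} → b ≤ a → mem a → mem b
      closed : ∀ {a} (c : Cov a) → (∀ u → U c u → mem u) → mem a
  open Ideal public

  infix 4 _⊑ᵢ_ _≈ᵢ_
  _⊑ᵢ_ : Ideal → Ideal → Set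
  I ⊑ᵢ J = ∀ b → mem I b → mem J b

  _≈ᵢ_ : Ideal → Ideal → Set
  I ≈ᵢ J = (I ⊑ᵢ J) × (J ⊑ᵢ I)

  data Gen (S : B → Set) : B → Set where
    inc : ∀ {a} → S a → Gen S a
    dn  : ∀ {a b} → b ≤ a → Gen S a → Gen S b
    cov : ∀ {a} (c : Cov a) → (∀ u → U c u → Gen S u) → Gen S a

  gen : (B → Set) → Ideal
  gen S = record { mem = Gen S ; down = dn ; closed = cov }

  emb : B → Ideal
  emb b = gen (λ x → x ≡ b)

  0ᵢ 1ᵢ : Ideal
  0ᵢ = gen (λ _ → ⊥)
  1ᵢ = record { mem = λ _ → ⊤ ; down = λ _ _ → _ ; closed = λ _ _ → _ }

  _∨ᵢ_ : Ideal → Ideal → Ideal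
  I ∨ᵢ J = gen (λ b → mem I b ⊎ mem J b)

  _∧ᵢ_ : Ideal → Ideal → Ideal
  I ∧ᵢ J = record
    { mem    = λ b → mem I b × mem J b
    ; down   = λ le p → down I le (proj₁ p) , down J le (proj₂ p)
    ; closed = λ c h → closed I c (λ u q → proj₁ (h u q))
                     , closed J c (λ u q → proj₂ (h u q)) }

  ⋁ᵢ : {Idx : Set} → (Idx → Ideal) → Ideal
  ⋁ᵢ {Idx} f = gen (λ b → Σ Idx λ i → mem (f i) b)

  ⋀ᵢ : {Idx : Set} → (Idx → Ideal) → Ideal
  ⋀ᵢ {Idx} f = record
    { mem    = λ b → (i : Idx) → mem (f i) b
    ; down   = λ le p i → down (f i) le (p i)
    ; closed = λ c h i → closed (f i) c (λ u q → h u q i) }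

module DFrame (P₊ P₋ : FramePresentation)
              (con₁ tot₁ : FramePresentation.B P₊ → FramePresentation.B P₋ → Set)
              where
  module L₊ = Pres P₊
  module L₋ = Pres P₋
  open FramePresentation using (B)

  Pair : Set₁
  Pair = L₊.Ideal × L₋.Ideal

  infix 30 _₊ _₋
  _₊ : Pair → L₊.Ideal
  α ₊ = proj₁ α
  _₋ : Pair → L₋.Ideal
  α ₋ = proj₂ α

  _⊑_ : Pair → Pair → Set
  α ⊑ β = (α ₊ L₊.⊑ᵢ β ₊) × (α ₋ L₋.⊑ᵢ β ₋)

  _⩔_ : Pair → Pair → Pair
  α ⩔ β = (α ₊ L₊.∨ᵢ β ₊) , (α ₋ L₋.∧ᵢ β ₋)

  _⩓_ : Pair → Pair → Pair
  α ⩓ β = (α ₊ L₊.∧ᵢ β ₊) , (α ₋ L₋.∨ᵢ β ₋)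

  tt ff : Pair
  tt = L₊.1ᵢ , L₋.0ᵢ
  ff = L₊.0ᵢ , L₋.1ᵢ

  -- con₁, tot₁ as subsets of L₊ × L₋ (via b ↦ smallest ideal containing b)
  data Con₁ : Pair → Set₁ where
    base : ∀ {a b} → con₁ a b → Con₁ (L₊.emb a , L₋.emb b)

  data Tot₁ : Pair → Set₁ where
    base : ∀ {a b} → tot₁ a b → Tot₁ (L₊.emb a , L₋.emb b)

  data Con∧∨ : Pair → Set₁ where
    base : ∀ {α} → Con₁ α → Con∧∨ α
    ttC  : Con∧∨ tt
    ffC  : Con∧∨ ff
    meet : ∀ {α β} → Con∧∨ α → Con∧∨ β → Con∧∨ (α ⩓ β)
    join : ∀ {α β} → Con∧∨ α → Con∧∨ β → Con∧∨ (α ⩔ β)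

  data Tot∧ : Pair → Set₁ where
    base : ∀ {α} → Tot₁ α → Tot∧ α
    ttT  : Tot∧ tt
    meet : ∀ {α β} → Tot∧ α → Tot∧ β → Tot∧ (α ⩓ β)

  data Tot∨ : Pair → Set₁ where
    base : ∀ {α} → Tot₁ α → Tot∨ α
    ffT  : Tot∨ ff
    join : ∀ {α β} → Tot∨ α → Tot∨ β → Tot∨ (α ⩔ β)

  Con⋁ : Pair → Set₁
  Con⋁ α = Σ Set λ Idx → Σ (Idx → Pair) λ f →
             ((i : Idx) → Con∧∨ (f i)) ×
             ((α ₊ L₊.≈ᵢ L₊.⋁ᵢ (λ i → f i ₊)) × (α ₋ L₋.≈ᵢ L₋.⋀ᵢ (λ i → f i ₋)))

  Con⋀ : Pair → Set₁
  Con⋀ α = Σ Set λ Idx → Σ (Idx → Pair) λ f →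
             ((i : Idx) → Con∧∨ (f i)) ×
             ((α ₊ L₊.≈ᵢ L₊.⋀ᵢ (λ i → f i ₊)) × (α ₋ L₋.≈ᵢ L₋.⋁ᵢ (λ i → f i ₋)))

  ↓_ : (Pair → Set₁) → Pair → Set₁
  (↓ R) α = Σ Pair λ β → R β × (α ⊑ β)

  Directed : {Idx : Set} → (Idx → Pair) → Set
  Directed {Idx} f = Idx × ((i j : Idx) → Σ Idx λ k → (f i ⊑ f k) × (f j ⊑ f k))

  𝒟 : (Pair → Set₁) → Pair → Set₁
  𝒟 R α = Σ Set λ Idx → Σ (Idx → Pair) λ f →
            ((i : Idx) → R (f i)) × Directed f ×
            ((α ₊ L₊.≈ᵢ L₊.⋁ᵢ (λ i → f i ₊)) × (α ₋ L₋.≈ᵢ L₋.⋁ᵢ (λ i → f i ₋)))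

  λ²₊ : Set₁
  λ²₊ = ∀ α β → 𝒟 (↓ Con∧∨) α → Tot∧ β → (β ₊ L₊.⊑ᵢ α ₊) → (α ₋ L₋.⊑ᵢ β ₋)

  λ²₋ : Set₁
  λ²₋ = ∀ α β → 𝒟 (↓ Con∧∨) α → Tot∨ β → (β ₋ L₋.⊑ᵢ α ₋) → (α ₊ L₊.⊑ᵢ β ₊)

  λ³₊ : Set₁
  λ³₊ = ∀ α β → Con⋁ α → Tot∧ β → (β ₊ L₊.⊑ᵢ α ₊) → (α ₋ L₋.⊑ᵢ β ₋)

  λ³₋ : Set₁
  λ³₋ = ∀ α β → Con⋀ α → Tot∨ β → (β ₋ L₋.⊑ᵢ α ₋) → (α ₊ L₊.⊑ᵢ β ₊)

-- Given α ∈ 𝒟(↓con_{∧,∨}) as the directed join of fᵢ ⊑ gᵢ ∈ con_{∧,∨}, fix i and pick for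
-- every j an index k(i,j) above both i and j.  The pair γⁱ = (⋁ⱼ g_{k(i,j)}₊ , ⋀ⱼ g_{k(i,j)}₋)
-- lies in con_{∧,∨,⋁}, its positive part dominates α₊ (because fⱼ ⊑ g_{k(i,j)}) and its
-- negative part dominates fᵢ₋ (because fᵢ ⊑ g_{k(i,j)}).  So (λ³₊) gives fᵢ₋ ≤ γⁱ₋ ≤ β₋ for
-- every i, hence α₋ = ⋁ᵢ fᵢ₋ ≤ β₋.  The negative case is the mirror image with ⋀ and ⋁ swapped.
module Submission where

open import Level using (0ℓ) renaming (suc to lsuc)
open import Function using (_∘_)
open import Data.Product using (_×_; _,_; proj₁; proj₂)
open import Relation.Binary.Bundles using (Preorder)
import Relation.Binary.Reasoning.Preorder as PreorderReasoning
open import Defs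

module IdealLattice (P : FramePresentation) where
  open Pres P

  ≈ᵢ-refl : ∀ I → I ≈ᵢ I
  ≈ᵢ-refl I = (λ _ x → x) , (λ _ x → x)

  ⊑ᵢ-preorder : Preorder (lsuc 0ℓ) 0ℓ 0ℓ
  ⊑ᵢ-preorder = record
    { Carrier    = Ideal
    ; _≈_        = _≈ᵢ_
    ; _≲_        = _⊑ᵢ_
    ; isPreorder = record
      { isEquivalence = record
        { refl  = λ {I} → ≈ᵢ-refl I
        ; sym   = λ (I⊑J , J⊑I) → J⊑I , I⊑J
        ; trans = λ (I⊑J , J⊑I) (J⊑K , K⊑J) → (λ b → J⊑K b ∘ I⊑J b) , (λ b → J⊑I b ∘ K⊑J b)
        }
      ; reflexive = proj₁
      ; trans     = λ I⊑J J⊑K b → J⊑K b ∘ I⊑J b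
      }
    }

  module ⊑ᵢ-Reasoning = PreorderReasoning ⊑ᵢ-preorder

  gen-least : ∀ {S} (I : Ideal) → (∀ b → S b → mem I b) → gen S ⊑ᵢ I
  gen-least I S⊆I b (inc s)    = S⊆I b s
  gen-least I S⊆I b (dn b≤a x) = down I b≤a (gen-least I S⊆I _ x)
  gen-least I S⊆I b (cov c x)  = closed I c (λ u u∈U → gen-least I S⊆I u (x u u∈U))

  ⋁ᵢ-least : ∀ {Idx} (f : Idx → Ideal) (I : Ideal) → (∀ i → f i ⊑ᵢ I) → ⋁ᵢ f ⊑ᵢ I
  ⋁ᵢ-least f I f⊑I = gen-least I (λ b (i , x) → f⊑I i b x)

  ⋁ᵢ-mono : ∀ {Idx} (f g : Idx → Ideal) → (∀ i → f i ⊑ᵢ g i) → ⋁ᵢ f ⊑ᵢ ⋁ᵢ g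
  ⋁ᵢ-mono f g f⊑g = ⋁ᵢ-least f (⋁ᵢ g) (λ i b x → inc (i , f⊑g i b x))

  ⋀ᵢ-greatest : ∀ {Idx} (f : Idx → Ideal) (I : Ideal) → (∀ i → I ⊑ᵢ f i) → I ⊑ᵢ ⋀ᵢ f
  ⋀ᵢ-greatest f I I⊑f b x i = I⊑f i b x

module _ (P₊ P₋ : FramePresentation)
         (con₁ tot₁ : FramePresentation.B P₊ → FramePresentation.B P₋ → Set) where
  open DFrame P₊ P₋ con₁ tot₁
  module I₊ = IdealLattice P₊
  module I₋ = IdealLattice P₋

  ⊑-trans : ∀ {α β γ} → α ⊑ β → β ⊑ γ → α ⊑ γ
  ⊑-trans (α₊⊑β₊ , α₋⊑β₋) (β₊⊑γ₊ , β₋⊑γ₋) =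
    (λ b → β₊⊑γ₊ b ∘ α₊⊑β₊ b) , (λ b → β₋⊑γ₋ b ∘ α₋⊑β₋ b)

  module DirectedBelow {Idx : Set} (f g : Idx → Pair)
                       (f⊑g : ∀ i → f i ⊑ g i) (dir : Directed f) where

    bound : Idx → Idx → Idx
    bound i j = proj₁ (proj₂ dir i j)

    above : Idx → Idx → Pair
    above i j = g (bound i j)

    ⊑above-left : ∀ i j → f i ⊑ above i j
    ⊑above-left i j = ⊑-trans {f i} {f (bound i j)} {above i j} (proj₁ (proj₂ (proj₂ dir i j))) (f⊑g _)

    ⊑above-right : ∀ i j → f j ⊑ above i j
    ⊑above-right i j = ⊑-trans {f j} {f (bound i j)} {above i j} (proj₂ (proj₂ (proj₂ dir i j))) (f⊑g _)

  λ³₊⇒λ²₊ : λ³₊ → λ²₊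
  λ³₊⇒λ²₊ λ³ α β (Idx , f , f⊑con , dir , (α₊⊑⋁ , _) , (α₋⊑⋁ , _)) β∈tot β₊⊑α₊ =
    let open I₋.⊑ᵢ-Reasoning in begin
    α ₋                       ≲⟨ α₋⊑⋁ ⟩
    L₋.⋁ᵢ (λ i → f i ₋)       ≲⟨ I₋.⋁ᵢ-least (λ i → f i ₋) (β ₋) fᵢ₋⊑β₋ ⟩
    β ₋                       ∎
    where
      open DirectedBelow f (λ i → proj₁ (f⊑con i)) (λ i → proj₂ (proj₂ (f⊑con i))) dir

      γ : Idx → Pair
      γ i = L₊.⋁ᵢ (λ j → above i j ₊) , L₋.⋀ᵢ (λ j → above i j ₋)

      γ∈con : ∀ i → Con⋁ (γ i)
      γ∈con i = Idx , above i , (λ j → proj₁ (proj₂ (f⊑con _)))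
              , I₊.≈ᵢ-refl (γ i ₊) , I₋.≈ᵢ-refl (γ i ₋)

      β₊⊑γ₊ : ∀ i → β ₊ L₊.⊑ᵢ γ i ₊
      β₊⊑γ₊ i = begin
        β ₊                   ≲⟨ β₊⊑α₊ ⟩
        α ₊                   ≲⟨ α₊⊑⋁ ⟩
        L₊.⋁ᵢ (λ j → f j ₊)   ≲⟨ I₊.⋁ᵢ-mono (λ j → f j ₊) (λ j → above i j ₊) (λ j → proj₁ (⊑above-right i j)) ⟩
        γ i ₊                 ∎
        where open I₊.⊑ᵢ-Reasoning

      fᵢ₋⊑β₋ : ∀ i → f i ₋ L₋.⊑ᵢ β ₋
      fᵢ₋⊑β₋ i = begin
        f i ₋   ≲⟨ I₋.⋀ᵢ-greatest (λ j → above i j ₋) (f i ₋) (λ j → proj₂ (⊑above-left i j)) ⟩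
        γ i ₋   ≲⟨ λ³ (γ i) β (γ∈con i) β∈tot (β₊⊑γ₊ i) ⟩
        β ₋     ∎
        where open I₋.⊑ᵢ-Reasoning

  λ³₋⇒λ²₋ : λ³₋ → λ²₋
  λ³₋⇒λ²₋ λ³ α β (Idx , f , f⊑con , dir , (α₊⊑⋁ , _) , (α₋⊑⋁ , _)) β∈tot β₋⊑α₋ =
    let open I₊.⊑ᵢ-Reasoning in begin
    α ₊                       ≲⟨ α₊⊑⋁ ⟩
    L₊.⋁ᵢ (λ i → f i ₊)       ≲⟨ I₊.⋁ᵢ-least (λ i → f i ₊) (β ₊) fᵢ₊⊑β₊ ⟩
    β ₊                       ∎
    where
      open DirectedBelow f (λ i → proj₁ (f⊑con i)) (λ i → proj₂ (proj₂ (f⊑con i))) dir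

      γ : Idx → Pair
      γ i = L₊.⋀ᵢ (λ j → above i j ₊) , L₋.⋁ᵢ (λ j → above i j ₋)

      γ∈con : ∀ i → Con⋀ (γ i)
      γ∈con i = Idx , above i , (λ j → proj₁ (proj₂ (f⊑con _)))
              , I₊.≈ᵢ-refl (γ i ₊) , I₋.≈ᵢ-refl (γ i ₋)

      β₋⊑γ₋ : ∀ i → β ₋ L₋.⊑ᵢ γ i ₋
      β₋⊑γ₋ i = begin
        β ₋                   ≲⟨ β₋⊑α₋ ⟩
        α ₋                   ≲⟨ α₋⊑⋁ ⟩
        L₋.⋁ᵢ (λ j → f j ₋)   ≲⟨ I₋.⋁ᵢ-mono (λ j → f j ₋) (λ j → above i j ₋) (λ j → proj₂ (⊑above-right i j)) ⟩
        γ i ₋                 ∎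
        where open I₋.⊑ᵢ-Reasoning

      fᵢ₊⊑β₊ : ∀ i → f i ₊ L₊.⊑ᵢ β ₊
      fᵢ₊⊑β₊ i = begin
        f i ₊   ≲⟨ I₊.⋀ᵢ-greatest (λ j → above i j ₊) (f i ₊) (λ j → proj₁ (⊑above-left i j)) ⟩
        γ i ₊   ≲⟨ λ³ (γ i) β (γ∈con i) β∈tot (β₋⊑γ₋ i) ⟩
        β ₊     ∎
        where open I₊.⊑ᵢ-Reasoning

lemma13 : (P₊ P₋ : FramePresentation)
          (con₁ tot₁ : FramePresentation.B P₊ → FramePresentation.B P₋ → Set) →
          (DFrame.λ³₊ P₊ P₋ con₁ tot₁ → DFrame.λ²₊ P₊ P₋ con₁ tot₁)
          × (DFrame.λ³₋ P₊ P₋ con₁ tot₁ → DFrame.λ²₋ P₊ P₋ con₁ tot₁)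
lemma13 P₊ P₋ con₁ tot₁ = λ³₊⇒λ²₊ P₊ P₋ con₁ tot₁ , λ³₋⇒λ²₋ P₊ P₋ con₁ tot₁
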